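{- Let $N$ be a network. Given a root choice function $\rho$ of $N$, there exists a unique rooted partner $N^+_\rho$ of $N$ whose set of roots is the image of $\rho$. Conversely, for any rooted partner $G$ of $N$ there exists a unique root choice function $\rho$ such that $G=N^+_\rho$.
   Context: A semidirected graph is $N=(V,E)$ with $E=E_U\sqcup E_D$, $E_U$ undirected edges $uv$, $E_D$ directed edges $(u,v)$ ($u$ parent, $v$ child); parallel directed edges allowed, no self-loops. $\deg_i(v,N)$ is the number of directed edges with child $v$. $N'$ is compatible with $N$ if obtained by directing some undirected edges. A semidirected cycle is a semidirected graph whose undirected edges can be directed to make it a directed cycle; acyclic (SDAG) means containing no semidirected cycle; DAG = acyclic directed graph. Tree node: $\deg_i\le1$; hybrid node otherwise. Hybrid edge: directed edge with hybrid child; $E_H(N)$ their set. SDAG $N'$ is phylogenetically compatible with SDAG $N$ if compatible and $E_H(N')=E_H(N)$; a rooted partner of $N$ is a DAG phylogenetically compatible with $N$; a network is an SDAG admitting a rooted partner. In a DAG a root is a node of in-degree 0. A semidirected path from $u_0$ to $u_n$ is $u_0\dots u_n$ with $u_{i-1}u_i$ or $(u_{i-1},u_i)$ an edge for each $i$; $v\lesssim u$ if there is a semidirected path from $u$ to $v$; $u\sim v$ if $u\lesssim v$ and $v\lesssim u$. An undirected component is the subgraph induced by a $\sim$-class; a root component is one whose class is maximal under $\lesssim$. A root choice function of $N$ is a map $\rho$ from the set of root components of $N$ to $V(N)$ with $\rho(T)\in V(T)$ for every root component $T$. -}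

module Defs where

open import Data.Nat using (ℕ; zero; suc; _+_; _≤_)
open import Data.Fin using (Fin; zero; suc; inject₁; fromℕ; _≟_)
open import Data.Bool using (Bool; true; false; if_then_else_; _∧_)
open import Data.Product using (Σ; ∃; ∃-syntax; _×_; _,_)
open import Data.Sum using (_⊎_)
open import Relation.Nullary using (¬_; ⌊_⌋)
open import Relation.Binary.PropositionalEquality using (_≡_; _≢_)
open import Relation.Binary.Construct.Closure.ReflexiveTransitive using (Star)
open import Function.Definitions using (Injective)
open import Function.Bundles using (_⇔_)

-- If directed e ≡ true, e is the directed edge (end₁ e , end₂ e)
-- (parent end₁ e, child end₂ e); otherwise e is the undirected edge
-- {end₁ e , end₂ e} (the order of the stored endpoints is irrelevant).

record SDGraph (n m : ℕ) : Set where
  field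
    end₁     : Fin m → Fin n
    end₂     : Fin m → Fin n
    directed : Fin m → Bool
open SDGraph public

SameEnds : ∀ {n} → Fin n → Fin n → Fin n → Fin n → Set
SameEnds a b c d = (a ≡ c × b ≡ d) ⊎ (a ≡ d × b ≡ c)

-- Semidirected graph: no self-loops, no parallel undirected edges
-- (E_U is a set of undirected edges); parallel directed edges allowed.
IsSemidirectedGraph : ∀ {n m} → SDGraph n m → Set
IsSemidirectedGraph {n} {m} N =
  (∀ e → end₁ N e ≢ end₂ N e) ×
  (∀ e e' → directed N e ≡ false → directed N e' ≡ false →
     SameEnds (end₁ N e) (end₂ N e) (end₁ N e') (end₂ N e') → e ≡ e')

Compatible : ∀ {n m} → SDGraph n m → SDGraph n m → Set
Compatible {n} {m} N N' = ∀ (e : Fin m) →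
  SameEnds (end₁ N' e) (end₂ N' e) (end₁ N e) (end₂ N e) ×
  (directed N e ≡ true →
     directed N' e ≡ true × end₁ N' e ≡ end₁ N e × end₂ N' e ≡ end₂ N e)

count : ∀ {m} → (Fin m → Bool) → ℕ
count {zero}  f = 0
count {suc m} f = (if f zero then 1 else 0) + count (λ i → f (suc i))

indeg : ∀ {n m} → SDGraph n m → Fin n → ℕ
indeg N v = count (λ e → directed N e ∧ ⌊ end₂ N e ≟ v ⌋)

IsHybridNode : ∀ {n m} → SDGraph n m → Fin n → Set
IsHybridNode N v = 2 ≤ indeg N v

IsHybridEdge : ∀ {n m} → SDGraph n m → Fin m → Set
IsHybridEdge N e = directed N e ≡ true × IsHybridNode N (end₂ N e)

SameHybridEdges : ∀ {n m} → SDGraph n m → SDGraph n m → Set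
SameHybridEdges {n} {m} N N' = ∀ (e : Fin m) → IsHybridEdge N e ⇔ IsHybridEdge N' e

Traverses : ∀ {n m} → SDGraph n m → Fin m → Fin n → Fin n → Set
Traverses N e u v =
  (directed N e ≡ true × end₁ N e ≡ u × end₂ N e ≡ v) ⊎
  (directed N e ≡ false × SameEnds (end₁ N e) (end₂ N e) u v)

Step : ∀ {n m} → SDGraph n m → Fin n → Fin n → Set
Step {n} {m} N u v = Σ (Fin m) λ e → Traverses N e u v

SDPath : ∀ {n m} → SDGraph n m → Fin n → Fin n → Set
SDPath N = Star (Step N)

_≲⟨_⟩_ : ∀ {n m} → Fin n → SDGraph n m → Fin n → Set
v ≲⟨ N ⟩ u = SDPath N u v

_∼⟨_⟩_ : ∀ {n m} → Fin n → SDGraph n m → Fin n → Set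
u ∼⟨ N ⟩ v = (u ≲⟨ N ⟩ v) × (v ≲⟨ N ⟩ u)

-- A semidirected cycle contained in N: distinct nodes
-- node 0 , … , node len (with node (len+1) = node 0) and distinct edges
-- edge i joining node i and node (i+1) which can be directed from
-- node i to node (i+1), forming a directed cycle.
record SDCycle {n m : ℕ} (N : SDGraph n m) : Set where
  field
    len    : ℕ
    node   : Fin (suc (suc len)) → Fin n
    edge   : Fin (suc len) → Fin m
    closed : node (fromℕ (suc len)) ≡ node zero
    nodes-distinct : Injective _≡_ _≡_ (λ i → node (inject₁ i))
    edges-distinct : Injective _≡_ _≡_ edge
    traverse : ∀ i → Traverses N (edge i) (node (inject₁ i)) (node (suc i))

IsSDAG : ∀ {n m} → SDGraph n m → Set
IsSDAG N = IsSemidirectedGraph N × ¬ SDCycle N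

IsDAG : ∀ {n m} → SDGraph n m → Set
IsDAG {n} {m} N = IsSDAG N × (∀ (e : Fin m) → directed N e ≡ true)

PhylogeneticallyCompatible : ∀ {n m} → SDGraph n m → SDGraph n m → Set
PhylogeneticallyCompatible N' N =
  IsSDAG N' × IsSDAG N × Compatible N N' × SameHybridEdges N N'

IsRootedPartner : ∀ {n m} → SDGraph n m → SDGraph n m → Set
IsRootedPartner N G = IsDAG G × PhylogeneticallyCompatible G N

IsNetwork : ∀ {n m} → SDGraph n m → Set
IsNetwork {n} {m} N = IsSDAG N × Σ (SDGraph n m) (IsRootedPartner N)

IsRoot : ∀ {n m} → SDGraph n m → Fin n → Set
IsRoot G v = indeg G v ≡ 0

-- v lies in a root component: its ∼-class is maximal under ≲
InRootComponent : ∀ {n m} → SDGraph n m → Fin n → Set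
InRootComponent {n} N v = ∀ (u : Fin n) → v ≲⟨ N ⟩ u → u ≲⟨ N ⟩ v

-- A root choice function, represented (setoid-style) as a function on
-- nodes of root components that is constant on each ∼-class and picks
-- a node of that class.  Two such functions represent the same root
-- choice function iff they agree on all nodes of root components.
IsRootChoice : ∀ {n m} → SDGraph n m → (Fin n → Fin n) → Set
IsRootChoice {n} N ρ =
  (∀ v → InRootComponent N v → ρ v ∼⟨ N ⟩ v) ×
  (∀ u v → InRootComponent N u → InRootComponent N v →
     u ∼⟨ N ⟩ v → ρ u ≡ ρ v)

SameRootChoice : ∀ {n m} → SDGraph n m → (Fin n → Fin n) → (Fin n → Fin n) → Set
SameRootChoice N ρ ρ' = ∀ v → InRootComponent N v → ρ v ≡ ρ' v

InImage : ∀ {n m} → SDGraph n m → (Fin n → Fin n) → Fin n → Set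
InImage {n} N ρ w = Σ (Fin n) λ v → InRootComponent N v × ρ v ≡ w

RootsAreImage : ∀ {n m} → SDGraph n m → SDGraph n m → (Fin n → Fin n) → Set
RootsAreImage N G ρ = ∀ w → IsRoot G w ⇔ InImage N ρ w

SameGraph : ∀ {n m} → SDGraph n m → SDGraph n m → Set
SameGraph {n} {m} G G' = ∀ (e : Fin m) →
  end₁ G e ≡ end₁ G' e × end₂ G e ≡ end₂ G' e × directed G e ≡ directed G' e

-- A rooted partner G of N is determined by its roots.  Following G from a root, every edge
-- met has the same orientation in any rooted partner G' having that root too: reversing an
-- N-undirected edge would give its head a second in-edge in G', i.e. a hybrid edge of G' that
-- is not one of N.  The same argument shows that an N-path ending at a root w of G is covered
-- backwards by a G-path from w, so roots of G lie in root components of N and roots joined by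
-- an N-path coincide; hence v ↦ (the G-root above v) is a root choice function whose image is
-- the set of roots of G, and the only one.
-- Conversely, given ρ, take any rooted partner G₀ and, in each root component, reverse the
-- edges of the G₀-path from its G₀-root r down to ρ(r).  Edges entering a root component are
-- N-undirected, so this keeps G₀ compatible with N and creates no hybrid node, while ρ(r)
-- becomes the root in place of r.

module Submission where

open import Defs
open import Data.Nat using (ℕ)
open import Data.Fin using (Fin)
open import Data.Product using (Σ; _×_)

open import Data.Nat as ℕ using (zero; suc; _+_; _∸_; _≤_; _<_; s≤s; _≤?_)
open import Data.Nat.Properties
  using (m≤n⇒m≤o+n; ≤-pred; n≢0⇒n>0; m∸n+n≡m; +-comm; ≤-total; ≰⇒≥; n<1+n)
open import Data.Fin using (zero; suc; toℕ; inject₁; fromℕ; fromℕ<; _≟_)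
open import Data.Fin.Properties
  using ( any?; pigeonhole; toℕ<n; toℕ-fromℕ; toℕ-fromℕ<; fromℕ≢inject₁; inject₁-injective
        ; suc-injective)
open import Data.Bool using (Bool; true; false; _∧_)
open import Data.Bool.Properties using (¬-not; not-¬) renaming (_≟_ to _≟ᵇ_)
open import Data.Product using (∃; ∃₂; proj₁; proj₂; _,_)
open import Data.Sum using (_⊎_; inj₁; inj₂)
open import Function using (_∘_; _⇔_; mk⇔; Equivalence)
open import Function.Construct.Composition using (_⇔-∘_)
open import Function.Construct.Symmetry using (⇔-sym)
open import Relation.Nullary using (¬_; Dec; yes; no; ⌊_⌋; contradiction)
open import Relation.Nullary.Decidable using (_×-dec_; map′)
open import Relation.Binary.PropositionalEquality
  using (_≡_; _≢_; refl; sym; trans; cong; subst; subst₂; module ≡-Reasoning)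
open import Relation.Binary.Construct.Closure.ReflexiveTransitive
  using (ε; _◅_; _◅◅_) renaming (map to mapStar)

module _ {n : ℕ} where

  SameEnds-sym : {a b c d : Fin n} → SameEnds a b c d → SameEnds c d a b
  SameEnds-sym (inj₁ (refl , refl)) = inj₁ (refl , refl)
  SameEnds-sym (inj₂ (refl , refl)) = inj₂ (refl , refl)

  SameEnds-trans : {a b c d e f : Fin n} → SameEnds a b c d → SameEnds c d e f → SameEnds a b e f
  SameEnds-trans (inj₁ (refl , refl)) q                    = q
  SameEnds-trans (inj₂ (refl , refl)) (inj₁ (refl , refl)) = inj₂ (refl , refl)
  SameEnds-trans (inj₂ (refl , refl)) (inj₂ (refl , refl)) = inj₁ (refl , refl)

  SameEnds-swap : {a b c d : Fin n} → SameEnds a b c d → SameEnds b a c d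
  SameEnds-swap (inj₁ (p , q)) = inj₂ (q , p)
  SameEnds-swap (inj₂ (p , q)) = inj₁ (q , p)

  SameEnds-first : {a b c d : Fin n} → SameEnds a b c d → a ≡ c ⊎ a ≡ d
  SameEnds-first (inj₁ (p , _)) = inj₁ p
  SameEnds-first (inj₂ (p , _)) = inj₂ p

Traverses⇒SameEnds : ∀ {n m} (H : SDGraph n m) {e u v} →
  Traverses H e u v → SameEnds (end₁ H e) (end₂ H e) u v
Traverses⇒SameEnds H (inj₁ (_ , p , q)) = inj₁ (p , q)
Traverses⇒SameEnds H (inj₂ (_ , s))     = s

module _ where
  private variable m : ℕ

  count≢0 : (f : Fin m → Bool) {e : Fin m} → f e ≡ true → count f ≢ 0
  count≢0 f {zero} fe rewrite fe = λ ()
  count≢0 f {suc e} fe with f zero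
  ... | true  = λ ()
  ... | false = count≢0 (f ∘ suc) fe

  count>0⇒witness : (f : Fin m → Bool) → 0 < count f → ∃ λ e → f e ≡ true
  count>0⇒witness {suc m} f c>0 with f zero in f₀
  ... | true  = zero , f₀
  ... | false = let e , fe = count>0⇒witness (f ∘ suc) c>0 in suc e , fe

  count≡0 : (f : Fin m → Bool) → (∀ e → f e ≡ false) → count f ≡ 0
  count≡0 {zero}  f _ = refl
  count≡0 {suc m} f allFalse rewrite allFalse zero = count≡0 (f ∘ suc) (allFalse ∘ suc)

  count≥2 : (f : Fin m → Bool) {e e' : Fin m} → e ≢ e' → f e ≡ true → f e' ≡ true → 2 ≤ count f
  count≥2 f {zero}  {zero}   e≢e' _  _   = contradiction refl e≢e'
  count≥2 f {zero}  {suc e'} _    fe fe' rewrite fe  = s≤s (n≢0⇒n>0 (count≢0 (f ∘ suc) fe'))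
  count≥2 f {suc e} {zero}   _    fe fe' rewrite fe' = s≤s (n≢0⇒n>0 (count≢0 (f ∘ suc) fe))
  count≥2 f {suc e} {suc e'} e≢e' fe fe' =
    m≤n⇒m≤o+n _ (count≥2 (f ∘ suc) (e≢e' ∘ cong suc) fe fe')

  count≥2⇒witnesses : (f : Fin m → Bool) → 2 ≤ count f →
    ∃₂ λ e e' → e ≢ e' × f e ≡ true × f e' ≡ true
  count≥2⇒witnesses {suc m} f 2≤c with f zero in f₀
  ... | true  = let e , fe = count>0⇒witness (f ∘ suc) (≤-pred 2≤c) in zero , suc e , (λ ()) , f₀ , fe
  ... | false = let e , e' , e≢e' , fe , fe' = count≥2⇒witnesses (f ∘ suc) 2≤c
                in suc e , suc e' , e≢e' ∘ suc-injective , fe , fe'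

  count-cong : {f g : Fin m → Bool} → (∀ e → f e ≡ true ⇔ g e ≡ true) → count f ≡ count g
  count-cong {zero}  _ = refl
  count-cong {suc m} {f} {g} f⇔g with f zero in f₀ | g zero in g₀
  ... | true  | true  = cong suc (count-cong (f⇔g ∘ suc))
  ... | false | false = count-cong (f⇔g ∘ suc)
  ... | true  | false = contradiction (trans (sym (Equivalence.to (f⇔g zero) f₀)) g₀) λ ()
  ... | false | true  = contradiction (trans (sym (Equivalence.from (f⇔g zero) g₀)) f₀) λ ()

module InEdges {n m : ℕ} (H : SDGraph n m) where

  InEdge : Fin m → Fin n → Set
  InEdge e v = directed H e ≡ true × end₂ H e ≡ v

  isInEdge : Fin n → Fin m → Bool
  isInEdge v e = directed H e ∧ ⌊ end₂ H e ≟ v ⌋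

  isInEdge⇔InEdge : ∀ {e v} → isInEdge v e ≡ true ⇔ InEdge e v
  isInEdge⇔InEdge {e} {v} = mk⇔ sound complete
    where
    sound : isInEdge v e ≡ true → InEdge e v
    sound p with directed H e | end₂ H e ≟ v
    ... | true | yes ev = refl , ev
    complete : InEdge e v → isInEdge v e ≡ true
    complete (d , ev) rewrite d with end₂ H e ≟ v
    ... | yes _  = refl
    ... | no ¬ev = contradiction ev ¬ev

  private
    isInEdge⇒InEdge : ∀ {e v} → isInEdge v e ≡ true → InEdge e v
    isInEdge⇒InEdge = Equivalence.to isInEdge⇔InEdge

    InEdge⇒isInEdge : ∀ {e v} → InEdge e v → isInEdge v e ≡ true
    InEdge⇒isInEdge = Equivalence.from isInEdge⇔InEdge

  root? : ∀ v → Dec (IsRoot H v)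
  root? v = indeg H v ℕ.≟ 0

  root⇒¬InEdge : ∀ {e v} → IsRoot H v → ¬ InEdge e v
  root⇒¬InEdge {v = v} r ie = count≢0 (isInEdge v) (InEdge⇒isInEdge ie) r

  ¬root⇒InEdge : ∀ {v} → ¬ IsRoot H v → ∃ λ e → InEdge e v
  ¬root⇒InEdge ¬r = let e , p = count>0⇒witness _ (n≢0⇒n>0 ¬r) in e , isInEdge⇒InEdge p

  noInEdge⇒root : ∀ {v} → (∀ e → ¬ InEdge e v) → IsRoot H v
  noInEdge⇒root none = count≡0 _ λ e → ¬-not (none e ∘ isInEdge⇒InEdge)

  InEdges⇒hybrid : ∀ {e e' v} → InEdge e v → InEdge e' v → e ≢ e' → IsHybridNode H v
  InEdges⇒hybrid ie ie' e≢e' = count≥2 _ e≢e' (InEdge⇒isInEdge ie) (InEdge⇒isInEdge ie')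

  hybrid⇒InEdges : ∀ {v} → IsHybridNode H v → ∃₂ λ e e' → e ≢ e' × InEdge e v × InEdge e' v
  hybrid⇒InEdges h = let e , e' , e≢e' , p , p' = count≥2⇒witnesses _ h in
    e , e' , e≢e' , isInEdge⇒InEdge p , isInEdge⇒InEdge p'


indeg-cong : ∀ {n m} (H H' : SDGraph n m) {v} →
  (∀ e → InEdges.InEdge H e v ⇔ InEdges.InEdge H' e v) → indeg H v ≡ indeg H' v
indeg-cong H H' same = count-cong λ e →
  ⇔-sym (InEdges.isInEdge⇔InEdge H') ⇔-∘ (same e ⇔-∘ InEdges.isInEdge⇔InEdge H)

module Walks {n m : ℕ} (H : SDGraph n m) where

  data Walk : ℕ → Fin n → Fin n → Set where
    []  : ∀ {a} → Walk 0 a a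
    _∷_ : ∀ {k a b c} → Step H a b → Walk k b c → Walk (suc k) a c

  walk : ∀ {a c} → SDPath H a c → ∃ λ k → Walk k a c
  walk ε       = _ , []
  walk (s ◅ p) = _ , s ∷ proj₂ (walk p)

  node : ∀ {k a c} → Walk k a c → Fin (suc k) → Fin n
  node {a = a} w       zero    = a
  node         (_ ∷ w) (suc i) = node w i

  edge : ∀ {k a c} → Walk k a c → Fin k → Fin m
  edge (s ∷ _) zero    = proj₁ s
  edge (_ ∷ w) (suc i) = edge w i

  node-last : ∀ {k a c} (w : Walk k a c) → node w (fromℕ k) ≡ c
  node-last []      = refl
  node-last (_ ∷ w) = node-last w

  traverses : ∀ {k a c} (w : Walk k a c) i → Traverses H (edge w i) (node w (inject₁ i)) (node w (suc i))
  traverses (s ∷ _) zero    = proj₂ s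
  traverses (_ ∷ w) (suc i) = traverses w i

  Avoids : ∀ {k a c} → Fin n → Walk k a c → Set
  Avoids x w = ∀ i → node w i ≢ x

  data Simple : ∀ {k a c} → Walk k a c → Set where
    []  : ∀ {a} → Simple ([] {a})
    _∷_ : ∀ {k a b c} {s : Step H a b} {w : Walk k b c} → Avoids a w → Simple w → Simple (s ∷ w)

  node-injective : ∀ {k a c} {w : Walk k a c} → Simple w → ∀ i j → node w i ≡ node w j → i ≡ j
  node-injective _        zero    zero    _ = refl
  node-injective (a∉ ∷ _) zero    (suc j) p = contradiction (sym p) (a∉ j)
  node-injective (a∉ ∷ _) (suc i) zero    p = contradiction p (a∉ i)
  node-injective (_ ∷ sw) (suc i) (suc j) p = cong suc (node-injective sw i j p)

  private
    first-edge-fresh : ∀ {k a b c e} {w : Walk k b c} → Avoids a w → Traverses H e a b →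
      ∀ j → e ≢ edge w j
    first-edge-fresh {w = w} a∉ t j e≡ with
      SameEnds-first (SameEnds-trans (SameEnds-sym (Traverses⇒SameEnds H t))
      (subst (λ f → SameEnds (end₁ H f) (end₂ H f) (node w (inject₁ j)) (node w (suc j))) (sym e≡)
        (Traverses⇒SameEnds H (traverses w j))))
    ... | inj₁ a≡ = a∉ (inject₁ j) (sym a≡)
    ... | inj₂ a≡ = a∉ (suc j) (sym a≡)

  edge-injective : ∀ {k a c} {w : Walk k a c} → Simple w → ∀ i j → edge w i ≡ edge w j → i ≡ j
  edge-injective _                      zero    zero    _  = refl
  edge-injective (_∷_ {s = _ , t} a∉ _) zero    (suc j) e≡ = contradiction e≡ (first-edge-fresh a∉ t j)
  edge-injective (_∷_ {s = _ , t} a∉ _) (suc i) zero    e≡ =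
    contradiction (sym e≡) (first-edge-fresh a∉ t i)
  edge-injective (_ ∷ sw)               (suc i) (suc j) e≡ = cong suc (edge-injective sw i j e≡)

  suffix : ∀ {k a c x} (w : Walk k a c) i → node w i ≡ x → Simple w →
    ∃ λ k' → Σ (Walk k' x c) Simple
  suffix w       zero    refl sw       = _ , w , sw
  suffix (_ ∷ w) (suc i) wᵢ≡x (_ ∷ sw) = suffix w i wᵢ≡x sw

  erase : ∀ {k a c} → Walk k a c → ∃ λ k' → Σ (Walk k' a c) Simple
  erase [] = _ , [] , []
  erase (_∷_ {a = a} s w) with erase w
  ... | _ , w' , sw' with any? (λ i → node w' i ≟ a)
  ...   | yes (i , w'ᵢ≡a) = suffix w' i w'ᵢ≡a sw'
  ...   | no  a∉w'        = _ , s ∷ w' , (λ i → a∉w' ∘ (i ,_)) ∷ sw'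

  closingEdge⇒SDCycle : ∀ {e x y} → directed H e ≡ true → end₁ H e ≡ x → end₂ H e ≡ y →
    SDPath H y x → SDCycle H
  closingEdge⇒SDCycle {e} {x} d refl refl p with erase (proj₂ (walk p))
  ... | k , w , sw = record
    { len            = k
    ; node           = node W
    ; edge           = edge W
    ; closed         = node-last W
    ; nodes-distinct = λ {i} {j} → nodes-distinct i j
    ; edges-distinct = λ {i} {j} → edges-distinct i j
    ; traverse       = traverses W
    }
    where
    W : Walk (suc k) x x
    W = (e , inj₁ (d , refl , refl)) ∷ w

    x∉inner : ∀ j → x ≢ node w (inject₁ j)
    x∉inner j x≡ = fromℕ≢inject₁ (node-injective sw (fromℕ k) (inject₁ j) (trans (node-last w) x≡))

    nodes-distinct : ∀ i j → node W (inject₁ i) ≡ node W (inject₁ j) → i ≡ j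
    nodes-distinct zero    zero    _ = refl
    nodes-distinct zero    (suc j) p = contradiction p (x∉inner j)
    nodes-distinct (suc i) zero    p = contradiction (sym p) (x∉inner i)
    nodes-distinct (suc i) (suc j) p = cong suc (inject₁-injective (node-injective sw _ _ p))

    e∉w : ∀ j → e ≢ edge w j
    e∉w j e≡ with subst (λ f → Traverses H f (node w (inject₁ j)) (node w (suc j)))
                        (sym e≡) (traverses w j)
    ... | inj₁ (_ , x≡ , _) = x∉inner j x≡
    ... | inj₂ (d' , _)     = not-¬ d' d

    edges-distinct : ∀ i j → edge W i ≡ edge W j → i ≡ j
    edges-distinct zero    zero    _ = refl
    edges-distinct zero    (suc j) p = contradiction p (e∉w j)
    edges-distinct (suc i) zero    p = contradiction (sym p) (e∉w i)
    edges-distinct (suc i) (suc j) p = cong suc (edge-injective sw i j p)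

module _ {n m : ℕ} {N H : SDGraph n m} (compatible : Compatible N H) where

  directedN⇒sameEnds : ∀ {e} → directed N e ≡ true → end₁ H e ≡ end₁ N e × end₂ H e ≡ end₂ N e
  directedN⇒sameEnds {e} d = proj₂ (proj₂ (compatible e) d)

  Traverses-compatible : ∀ {e u v} → Traverses H e u v → Traverses N e u v
  Traverses-compatible {e} t with directed N e in d
  ... | false =
    inj₂ (refl , SameEnds-trans (SameEnds-sym (proj₁ (compatible e))) (Traverses⇒SameEnds H t))
  ... | true with t | proj₂ (compatible e) d
  ...   | inj₁ (_ , p , q) | _ , e₁ , e₂ = inj₁ (refl , trans (sym e₁) p , trans (sym e₂) q)
  ...   | inj₂ (u , _)     | d' , _      = contradiction d' (not-¬ u)

  SDPath-compatible : ∀ {u v} → SDPath H u v → SDPath N u v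
  SDPath-compatible = mapStar λ (e , t) → e , Traverses-compatible t

  SDCycle-compatible : SDCycle H → SDCycle N
  SDCycle-compatible C = record
    { SDCycle C ; traverse = Traverses-compatible ∘ SDCycle.traverse C }

  traversal-orientation : ∀ {e u v} → Traverses N e u v →
    (end₁ H e ≡ u × end₂ H e ≡ v) ⊎ (directed N e ≡ false × end₁ H e ≡ v × end₂ H e ≡ u)
  traversal-orientation {e} (inj₁ (d , p , q)) =
    let e₁ , e₂ = directedN⇒sameEnds d in inj₁ (trans e₁ p , trans e₂ q)
  traversal-orientation {e} (inj₂ (u , s)) with SameEnds-trans (proj₁ (compatible e)) s
  ... | inj₁ same     = inj₁ same
  ... | inj₂ (p , q) = inj₂ (u , p , q)

module _ {n m : ℕ} {N : SDGraph n m} where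

  InRootComponent-source : ∀ {x y} → SDPath N x y → InRootComponent N y → InRootComponent N x
  InRootComponent-source x⇝y y-root u u⇝x = x⇝y ◅◅ y-root u (u⇝x ◅◅ x⇝y)

  InRootComponent-noDirectedInEdge : ¬ SDCycle N → ∀ {c} → InRootComponent N c →
    ∀ f → directed N f ≡ true → end₂ N f ≢ c
  InRootComponent-noDirectedInEdge acyclic c-root f d f→c =
    acyclic (Walks.closingEdge⇒SDCycle N d refl f→c
      (c-root (end₁ N f) ((f , inj₁ (d , refl , f→c)) ◅ ε)))

  ∼-sym : ∀ {u v} → u ∼⟨ N ⟩ v → v ∼⟨ N ⟩ u
  ∼-sym (p , q) = q , p

  ∼-trans : ∀ {u v w} → u ∼⟨ N ⟩ v → v ∼⟨ N ⟩ w → u ∼⟨ N ⟩ w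
  ∼-trans (p , q) (r , s) = r ◅◅ p , q ◅◅ s

  rootChoice-unique : ∀ {ρ ρ'} → IsRootChoice N ρ' → IsRootChoice N ρ →
    (∀ w → InImage N ρ' w → InImage N ρ w) → SameRootChoice N ρ' ρ
  rootChoice-unique {ρ} {ρ'} (ρ'∼ , _) (ρ∼ , ρ-constant) image⊆ v v-root
    with image⊆ (ρ' v) (v , v-root , refl)
  ... | u , u-root , ρu≡ρ'v = trans (sym ρu≡ρ'v) (ρ-constant u v u-root v-root u∼v)
    where
    u∼v : u ∼⟨ N ⟩ v
    u∼v = ∼-trans (∼-sym (ρ∼ u u-root)) (subst (λ x → x ∼⟨ N ⟩ v) (sym ρu≡ρ'v) (ρ'∼ v v-root))

module RootedPartner {n m : ℕ} (N H : SDGraph n m) (partner : IsRootedPartner N H) where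

  open InEdges H public

  directedH : ∀ e → directed H e ≡ true
  directedH = proj₂ (proj₁ partner)

  noLoopH : ∀ e → end₁ H e ≢ end₂ H e
  noLoopH = proj₁ (proj₁ (proj₁ (proj₁ partner)))

  acyclicH : ¬ SDCycle H
  acyclicH = proj₂ (proj₁ (proj₁ partner))

  sdagN : IsSDAG N
  sdagN = proj₁ (proj₂ (proj₂ partner))

  compatible : Compatible N H
  compatible = proj₁ (proj₂ (proj₂ (proj₂ partner)))

  sameHybrid : SameHybridEdges N H
  sameHybrid = proj₂ (proj₂ (proj₂ (proj₂ partner)))

  head-nonroot : ∀ e → ¬ IsRoot H (end₂ H e)
  head-nonroot e r = root⇒¬InEdge r (directedH e , refl)

  sameHead⇒directedN : ∀ {e f} → e ≢ f → end₂ H e ≡ end₂ H f → directed N e ≡ true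
  sameHead⇒directedN {e} {f} e≢f e→f = proj₁ (Equivalence.from (sameHybrid e) (directedH e ,
    InEdges⇒hybrid (directedH e , refl) (directedH f , sym e→f) e≢f))

  undirected-InEdge-unique : ∀ {e f} → directed N e ≡ false → end₂ H f ≡ end₂ H e → f ≡ e
  undirected-InEdge-unique {e} {f} u f→e with f ≟ e
  ... | yes f≡e = f≡e
  ... | no  f≢e = contradiction (sameHead⇒directedN (f≢e ∘ sym) (sym f→e)) (not-¬ u)

  undirected-sameEnds⇒≡ : ∀ {e f} → directed N e ≡ false → directed N f ≡ false →
    SameEnds (end₁ H e) (end₂ H e) (end₁ H f) (end₂ H f) → e ≡ f
  undirected-sameEnds⇒≡ {e} {f} ue uf same = proj₂ (proj₁ sdagN) e f ue uf
    (SameEnds-trans (SameEnds-sym (proj₁ (compatible e))) (SameEnds-trans same (proj₁ (compatible f))))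

  -- Directed paths of H, grown at the end so that the last edge into the target is exposed.
  data Reach (w : Fin n) : Fin n → Set where
    here : Reach w w
    step : ∀ {y} e → Reach w (end₁ H e) → end₂ H e ≡ y → Reach w y

  Reach⇒SDPathH : ∀ {w y} → Reach w y → SDPath H w y
  Reach⇒SDPathH here           = ε
  Reach⇒SDPathH (step e P refl) = Reach⇒SDPathH P ◅◅ (e , inj₁ (directedH e , refl , refl)) ◅ ε

  Reach⇒SDPath : ∀ {w y} → Reach w y → SDPath N w y
  Reach⇒SDPath = SDPath-compatible compatible ∘ Reach⇒SDPathH

  Reach-trans : ∀ {a b c} → Reach a b → Reach b c → Reach a c
  Reach-trans P here          = P
  Reach-trans P (step e Q eq) = step e (Reach-trans P Q) eq

  Reach-head : ∀ {w e} → IsRoot H w → Reach w (end₂ H e) →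
    Reach w (end₁ H e) ⊎
    (directed N e ≡ true × ∃ λ f → directed N f ≡ true × end₂ H f ≡ end₂ H e × Reach w (end₁ H f))
  Reach-head {e = e} w-root here = contradiction w-root (head-nonroot e)
  Reach-head {e = e} w-root (step f P f→e) with f ≟ e
  ... | yes refl = inj₁ P
  ... | no  f≢e  =
    inj₂ (sameHead⇒directedN (f≢e ∘ sym) (sym f→e) , f , sameHead⇒directedN f≢e f→e , f→e , P)

  Reach-++ : ∀ {w y z} → IsRoot H w → Reach w y → SDPath N y z → Reach w z
  Reach-++ w-root P ε = P
  Reach-++ w-root P ((e , t) ◅ p) with traversal-orientation compatible t
  ... | inj₁ (refl , refl) = Reach-++ w-root (step e P refl) p
  ... | inj₂ (u , refl , refl) with Reach-head w-root P
  ...   | inj₁ P'          = Reach-++ w-root P' p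
  ...   | inj₂ (d , _)     = contradiction d (not-¬ u)

  SDPath-roots⇒≡ : ∀ {r r'} → IsRoot H r → IsRoot H r' → SDPath N r r' → r ≡ r'
  SDPath-roots⇒≡ r-root r'-root p with Reach-++ r-root here p
  ... | here          = refl
  ... | step e _ refl = contradiction r'-root (head-nonroot e)

  SDPath⇒Reach : ∀ {w u} → IsRoot H w → SDPath N u w → Reach w u
  SDPath⇒Reach w-root ε = here
  SDPath⇒Reach w-root ((e , t) ◅ p) with traversal-orientation compatible t
  ... | inj₂ (_ , refl , refl) = step e (SDPath⇒Reach w-root p) refl
  ... | inj₁ (refl , refl) with Reach-head w-root (SDPath⇒Reach w-root p)
  ...   | inj₁ P = P
  ...   | inj₂ (_ , f , d , f→e , P) = contradiction cycle (proj₂ sdagN)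
    where
    cycle : SDCycle N
    cycle = let f₁ , f₂ = directedN⇒sameEnds compatible d in
      Walks.closingEdge⇒SDCycle N d (sym f₁) (trans (sym f₂) f→e) (p ◅◅ Reach⇒SDPath P)

  root⇒InRootComponent : ∀ {w} → IsRoot H w → InRootComponent N w
  root⇒InRootComponent w-root u p = Reach⇒SDPath (SDPath⇒Reach w-root p)

  -- Roots are their own parent; a hybrid node gets an arbitrary one of its parents.
  parent : Fin n → Fin n
  parent x with root? x
  ... | yes _  = x
  ... | no  ¬r = end₁ H (proj₁ (¬root⇒InEdge ¬r))

  parent-root : ∀ {x} → IsRoot H x → parent x ≡ x
  parent-root {x} r with root? x
  ... | yes _  = refl
  ... | no  ¬r = contradiction r ¬r

  parent-InEdge : ∀ {x} → ¬ IsRoot H x → ∃ λ e → end₂ H e ≡ x × end₁ H e ≡ parent x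
  parent-InEdge {x} ¬r with root? x
  ... | yes r   = contradiction r ¬r
  ... | no  ¬r' = let e , _ , e→x = ¬root⇒InEdge ¬r' in e , e→x , refl

  parent-Reach : ∀ x → Reach (parent x) x
  parent-Reach x with root? x
  ... | yes _  = here
  ... | no  ¬r = let e , _ , e→x = ¬root⇒InEdge ¬r in step e here e→x

  undirected⇒parent : ∀ {e} → directed N e ≡ false → parent (end₂ H e) ≡ end₁ H e
  undirected⇒parent {e} u =
    let f , f→ , f₁ = parent-InEdge (head-nonroot e) in
    trans (sym f₁) (cong (end₁ H) (undirected-InEdge-unique u f→))

  parent^ : ℕ → Fin n → Fin n
  parent^ zero    x = x
  parent^ (suc k) x = parent (parent^ k x)

  -- n steps suffice: a longer parent chain repeats a node, which must be a root (rootOf-root).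
  rootOf : Fin n → Fin n
  rootOf = parent^ n

  parent^-+ : ∀ a b x → parent^ (a + b) x ≡ parent^ a (parent^ b x)
  parent^-+ zero    b x = refl
  parent^-+ (suc a) b x = cong parent (parent^-+ a b x)

  parent^-parent : ∀ k x → parent^ k (parent x) ≡ parent (parent^ k x)
  parent^-parent zero    x = refl
  parent^-parent (suc k) x = cong parent (parent^-parent k x)

  parent^-≤ : ∀ {i j} x → i ≤ j → parent^ j x ≡ parent^ (j ∸ i) (parent^ i x)
  parent^-≤ {i} {j} x i≤j =
    trans (cong (λ k → parent^ k x) (sym (m∸n+n≡m i≤j))) (parent^-+ (j ∸ i) i x)

  parent^-root : ∀ k {x} → IsRoot H x → parent^ k x ≡ x
  parent^-root zero    r = refl
  parent^-root (suc k) r = trans (cong parent (parent^-root k r)) (parent-root r)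

  parent^-stable : ∀ {i j} x → IsRoot H (parent^ i x) → i ≤ j → parent^ j x ≡ parent^ i x
  parent^-stable {i} {j} x r i≤j = trans (parent^-≤ x i≤j) (parent^-root (j ∸ i) r)

  parent^-Reach : ∀ k x → Reach (parent^ k x) x
  parent^-Reach zero    x = here
  parent^-Reach (suc k) x = Reach-trans (parent-Reach (parent^ k x)) (parent^-Reach k x)

  Ancestor : Fin n → Fin n → Set
  Ancestor b x = ∃ λ i → parent^ i x ≡ b

  Ancestor⇒Reach : ∀ {b x} → Ancestor b x → Reach b x
  Ancestor⇒Reach (i , refl) = parent^-Reach i _

  ¬Ancestor-parent : ∀ {b} → ¬ IsRoot H b → ¬ Ancestor b (parent b)
  ¬Ancestor-parent ¬r b≤parent =
    let e , e→b , e₁ = parent-InEdge ¬r in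
    acyclicH (Walks.closingEdge⇒SDCycle H (directedH e) e₁ e→b
      (Reach⇒SDPathH (Ancestor⇒Reach b≤parent)))

  repeat⇒root : ∀ {i j} x → i < j → parent^ i x ≡ parent^ j x → IsRoot H (parent^ i x)
  repeat⇒root {i} {j} x i<j xᵢ≡xⱼ with root? (parent^ i x)
  ... | yes r  = r
  ... | no  ¬r = contradiction (j ∸ suc i , sym (trans xᵢ≡xⱼ (parent^-≤ x i<j))) (¬Ancestor-parent ¬r)

  rootOf-root : ∀ x → IsRoot H (rootOf x)
  rootOf-root x =
    let i , _ , i<j , xᵢ≡xⱼ = pigeonhole (n<1+n n) (λ (i : Fin (suc n)) → parent^ (toℕ i) x)
        r = repeat⇒root x i<j xᵢ≡xⱼ
    in subst (IsRoot H) (sym (parent^-stable x r (≤-pred (toℕ<n i)))) r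

  rootOf-Ancestor : ∀ {b x} → Ancestor b x → rootOf b ≡ rootOf x
  rootOf-Ancestor {x = x} (i , refl) = begin
    parent^ n (parent^ i x)  ≡⟨ parent^-+ n i x ⟨
    parent^ (n + i) x        ≡⟨ cong (λ k → parent^ k x) (+-comm n i) ⟩
    parent^ (i + n) x        ≡⟨ parent^-+ i n x ⟩
    parent^ i (rootOf x)     ≡⟨ parent^-root i (rootOf-root x) ⟩
    rootOf x                 ∎
    where open ≡-Reasoning

  Ancestor? : ∀ b x → Dec (Ancestor b x)
  Ancestor? b x =
    map′ (λ (i , p) → toℕ i , p) bounded (any? λ (i : Fin (suc n)) → parent^ (toℕ i) x ≟ b)
    where
    bounded : Ancestor b x → ∃ λ (i : Fin (suc n)) → parent^ (toℕ i) x ≡ b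
    bounded (i , p) with i ≤? n
    ... | yes i≤n = fromℕ< (s≤s i≤n) , trans (cong (λ k → parent^ k x) (toℕ-fromℕ< (s≤s i≤n))) p
    ... | no  i≰n = fromℕ n , trans (cong (λ k → parent^ k x) (toℕ-fromℕ n))
                                (trans (sym (parent^-stable x (rootOf-root x) (≰⇒≥ i≰n))) p)

  Ancestor-last : ∀ {w x} → Ancestor w x → x ≢ w → ∃ λ c → parent c ≡ w × c ≢ w × Ancestor c x
  Ancestor-last {w} {x} (i , p) x≢w = last i p
    where
    last : ∀ i → parent^ i x ≡ w → ∃ λ c → parent c ≡ w × c ≢ w × Ancestor c x
    last zero    x≡w = contradiction x≡w x≢w
    last (suc i) p with parent^ i x ≟ w
    ... | yes q   = last i q
    ... | no  c≢w = parent^ i x , p , c≢w , i , refl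

  Ancestor-comparable : ∀ {b b' x} → Ancestor b x → Ancestor b' x → Ancestor b' b ⊎ Ancestor b b'
  Ancestor-comparable {x = x} (i , refl) (j , refl) with ≤-total i j
  ... | inj₁ i≤j = inj₁ (j ∸ i , sym (parent^-≤ x i≤j))
  ... | inj₂ j≤i = inj₂ (i ∸ j , sym (parent^-≤ x j≤i))

  Ancestor-sameParent⇒≡ : ∀ {c d} → Ancestor c d → ¬ IsRoot H c → parent d ≡ parent c → d ≡ c
  Ancestor-sameParent⇒≡ (zero  , d≡c) _  _ = d≡c
  Ancestor-sameParent⇒≡ {c} {d} (suc k , p) ¬r parents =
    contradiction (k , trans (cong (parent^ k) (sym parents)) (trans (parent^-parent k d) p))
                  (¬Ancestor-parent ¬r)

  Ancestor-parent-injective : ∀ {b b' x} → Ancestor b x → Ancestor b' x →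
    ¬ IsRoot H b → ¬ IsRoot H b' → parent b ≡ parent b' → b ≡ b'
  Ancestor-parent-injective b≤x b'≤x ¬r ¬r' parents with Ancestor-comparable b≤x b'≤x
  ... | inj₁ b'≤b = Ancestor-sameParent⇒≡ b'≤b ¬r' parents
  ... | inj₂ b≤b' = sym (Ancestor-sameParent⇒≡ b≤b' ¬r (sym parents))

  rootOf-SDPath : ∀ v → SDPath N (rootOf v) v
  rootOf-SDPath v = Reach⇒SDPath (parent^-Reach n v)

  rootOf-isRootChoice : IsRootChoice N rootOf
  rootOf-isRootChoice =
    (λ v v-root → v-root (rootOf v) (rootOf-SDPath v) , rootOf-SDPath v) ,
    (λ u v _ v-root (_ , u⇝v) → SDPath-roots⇒≡ (rootOf-root u) (rootOf-root v)
       (rootOf-SDPath u ◅◅ u⇝v ◅◅ v-root (rootOf v) (rootOf-SDPath v)))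

  rootOf-roots : RootsAreImage N H rootOf
  rootOf-roots w = mk⇔
    (λ w-root → w , root⇒InRootComponent w-root , parent^-root n w-root)
    (λ { (v , _ , refl) → rootOf-root v })

module _ {n m : ℕ} {N G G' : SDGraph n m}
         (partner : IsRootedPartner N G) (partner' : IsRootedPartner N G') where
  private
    module P  = RootedPartner N G  partner
    module P' = RootedPartner N G' partner'

  orientation-agrees : ∀ {w e} → IsRoot G' w → P.Reach w (end₁ G e) →
    end₁ G' e ≡ end₁ G e × end₂ G' e ≡ end₂ G e
  reversed-unreachable : ∀ {w e} → IsRoot G' w → P.Reach w (end₁ G e) → directed N e ≡ false →
    end₂ G' e ≢ end₁ G e

  orientation-agrees {w} {e} w-root P with directed N e in d
  ... | true  = let e₁  , e₂  = directedN⇒sameEnds P.compatible d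
                    e₁' , e₂' = directedN⇒sameEnds P'.compatible d
                in trans e₁' (sym e₁) , trans e₂' (sym e₂)
  ... | false with SameEnds-trans (proj₁ (P'.compatible e)) (SameEnds-sym (proj₁ (P.compatible e)))
  ...   | inj₁ same     = same
  ...   | inj₂ (_ , e₂') = contradiction e₂' (reversed-unreachable w-root P d)

  reversed-unreachable {e = e} w-root P.here _ e→w = P'.root⇒¬InEdge w-root (P'.directedH e , e→w)
  reversed-unreachable {e = e} w-root (P.step f P f→) u e→ with f ≟ e
  ... | yes refl = P.noLoopH f (sym f→)
  ... | no  f≢e  = contradiction (P'.sameHead⇒directedN (f≢e ∘ sym) e→f) (not-¬ u)
    where
    e→f : end₂ G' e ≡ end₂ G' f
    e→f = trans e→ (sym (trans (proj₂ (orientation-agrees w-root P)) f→))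

  rootedPartner-determinedByRoots : (∀ w → IsRoot G w → IsRoot G' w) → SameGraph G' G
  rootedPartner-determinedByRoots roots⊆ e =
    let e₁ , e₂ = orientation-agrees (roots⊆ _ (P.rootOf-root (end₁ G e))) (P.parent^-Reach n (end₁ G e))
    in e₁ , e₂ , trans (P'.directedH e) (sym (P.directedH e))

module Reroot {n m : ℕ} {N G₀ : SDGraph n m} (partner₀ : IsRootedPartner N G₀)
              {ρ : Fin n → Fin n} (rootChoice : IsRootChoice N ρ) where

  open RootedPartner N G₀ partner₀

  newRoot : Fin n → Fin n
  newRoot x = ρ (rootOf x)

  -- b lies on the G₀-path from its G₀-root down to the chosen node newRoot b.
  OnNewRootPath : Fin n → Set
  OnNewRootPath b = Ancestor b (newRoot b)

  Reversed : Fin m → Set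
  Reversed e = directed N e ≡ false × OnNewRootPath (end₂ G₀ e)

  reversed? : ∀ e → Dec (Reversed e)
  reversed? e = (directed N e ≟ᵇ false) ×-dec Ancestor? _ _

  reorient : ∀ {e} → Dec (Reversed e) → Fin n × Fin n
  reorient {e} (yes _) = end₂ G₀ e , end₁ G₀ e
  reorient {e} (no  _) = end₁ G₀ e , end₂ G₀ e

  rerooted : SDGraph n m
  rerooted = record
    { end₁     = λ e → proj₁ (reorient (reversed? e))
    ; end₂     = λ e → proj₂ (reorient (reversed? e))
    ; directed = λ _ → true
    }

  module R = InEdges rerooted

  rerooted-ends : ∀ e →
    (Reversed e × end₁ rerooted e ≡ end₂ G₀ e × end₂ rerooted e ≡ end₁ G₀ e) ⊎
    (¬ Reversed e × end₁ rerooted e ≡ end₁ G₀ e × end₂ rerooted e ≡ end₂ G₀ e)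
  rerooted-ends e with reversed? e
  ... | yes rev  = inj₁ (rev , refl , refl)
  ... | no  ¬rev = inj₂ (¬rev , refl , refl)

  rootOf-InRootComponent : ∀ x → InRootComponent N (rootOf x)
  rootOf-InRootComponent x = root⇒InRootComponent (rootOf-root x)

  newRoot∼rootOf : ∀ x → newRoot x ∼⟨ N ⟩ rootOf x
  newRoot∼rootOf x = proj₁ rootChoice (rootOf x) (rootOf-InRootComponent x)

  newRoot-InRootComponent : ∀ x → InRootComponent N (newRoot x)
  newRoot-InRootComponent x = InRootComponent-source (proj₂ (newRoot∼rootOf x)) (rootOf-InRootComponent x)

  rootOf-newRoot : ∀ x → rootOf (newRoot x) ≡ rootOf x
  rootOf-newRoot x = SDPath-roots⇒≡ (rootOf-root (newRoot x)) (rootOf-root x)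
    (rootOf-SDPath (newRoot x) ◅◅ proj₂ (newRoot∼rootOf x))

  Ancestor-newRoot⇒OnNewRootPath : ∀ {b x} → Ancestor b (newRoot x) → OnNewRootPath b
  Ancestor-newRoot⇒OnNewRootPath {b} {x} b≤ =
    subst (Ancestor b) (cong ρ (sym (trans (rootOf-Ancestor b≤) (rootOf-newRoot x)))) b≤

  newRoot-parent : ∀ b → newRoot (parent b) ≡ newRoot b
  newRoot-parent b = cong ρ (rootOf-Ancestor (1 , refl))

  OnNewRootPath-parent : ∀ {b} → OnNewRootPath b → OnNewRootPath (parent b)
  OnNewRootPath-parent (i , p) = Ancestor-newRoot⇒OnNewRootPath (suc i , cong parent p)

  OnNewRootPath⇒InRootComponent : ∀ {b} → OnNewRootPath b → InRootComponent N b
  OnNewRootPath⇒InRootComponent {b} b≤ =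
    InRootComponent-source (Reach⇒SDPath (Ancestor⇒Reach b≤)) (newRoot-InRootComponent b)

  InRootComponent⇒undirected : ∀ {f c} → end₂ G₀ f ≡ c → InRootComponent N c → directed N f ≡ false
  InRootComponent⇒undirected {f} f→c c-root = ¬-not λ d →
    InRootComponent-noDirectedInEdge (proj₂ sdagN) c-root f d
      (trans (sym (proj₂ (directedN⇒sameEnds compatible d))) f→c)

  reversed-tail : ∀ {e} → Reversed e → OnNewRootPath (end₁ G₀ e)
  reversed-tail (u , onPath) = subst OnNewRootPath (undirected⇒parent u) (OnNewRootPath-parent onPath)

  reversed-sameTail⇒≡ : ∀ {e f} → Reversed e → Reversed f → end₁ G₀ e ≡ end₁ G₀ f → e ≡ f
  reversed-sameTail⇒≡ {e} {f} (ue , e-onPath) (uf , f-onPath) tails =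
    undirected-sameEnds⇒≡ ue uf (inj₁ (tails , heads))
    where
    parents : parent (end₂ G₀ e) ≡ parent (end₂ G₀ f)
    parents = trans (undirected⇒parent ue) (trans tails (sym (undirected⇒parent uf)))
    f≤newRoot-e : Ancestor (end₂ G₀ f) (newRoot (end₂ G₀ e))
    f≤newRoot-e = subst (Ancestor _)
      (trans (sym (newRoot-parent _)) (trans (cong newRoot (sym parents)) (newRoot-parent _))) f-onPath
    heads : end₂ G₀ e ≡ end₂ G₀ f
    heads = Ancestor-parent-injective e-onPath f≤newRoot-e (head-nonroot e) (head-nonroot f) parents

  rerooted-undirected-InEdge-unique : ∀ {e f} → directed N e ≡ false →
    R.InEdge f (end₂ rerooted e) → f ≡ e
  rerooted-undirected-InEdge-unique {e} {f} ue (_ , f→e) with rerooted-ends e | rerooted-ends f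
  ... | inj₂ (_ , _ , e₂) | inj₂ (_ , _ , f₂) =
    undirected-InEdge-unique ue (trans (sym f₂) (trans f→e e₂))
  ... | inj₂ (¬rev-e , _ , e₂) | inj₁ (rev-f , _ , f₂) =
    contradiction (ue , subst OnNewRootPath (trans (sym f₂) (trans f→e e₂)) (reversed-tail rev-f)) ¬rev-e
  ... | inj₁ (rev-e , _ , e₂) | inj₂ (¬rev-f , _ , f₂) =
    contradiction (InRootComponent⇒undirected f→tail (OnNewRootPath⇒InRootComponent tail-onPath) ,
                   subst OnNewRootPath (sym f→tail) tail-onPath) ¬rev-f
    where
    tail-onPath = reversed-tail rev-e
    f→tail = trans (sym f₂) (trans f→e e₂)
  ... | inj₁ (rev-e , _ , e₂) | inj₁ (rev-f , _ , f₂) =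
    reversed-sameTail⇒≡ rev-f rev-e (trans (sym f₂) (trans f→e e₂))

  InEdge-outsideRootComponents : ∀ {c} → ¬ InRootComponent N c → ∀ f → R.InEdge f c ⇔ InEdge f c
  InEdge-outsideRootComponents ¬c-root f with rerooted-ends f
  ... | inj₁ (rev , _ , f₂) = mk⇔
    (λ (_ , f→c) → contradiction (subst (InRootComponent N) (trans (sym f₂) f→c)
                                    (OnNewRootPath⇒InRootComponent (reversed-tail rev))) ¬c-root)
    (λ (_ , f→c) → contradiction (subst (InRootComponent N) f→c
                                    (OnNewRootPath⇒InRootComponent (proj₂ rev))) ¬c-root)
  ... | inj₂ (_ , _ , f₂) = mk⇔
    (λ (_ , f→c) → directedH f , trans (sym f₂) f→c)
    (λ (_ , f→c) → refl , trans f₂ f→c)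

  directed-unreversed : ∀ {e} → directed N e ≡ true → end₂ rerooted e ≡ end₂ G₀ e
  directed-unreversed {e} d with rerooted-ends e
  ... | inj₁ ((u , _) , _) = contradiction d (not-¬ u)
  ... | inj₂ (_ , _ , e₂)  = e₂

  directed-sameHybrid : ∀ {e} → directed N e ≡ true → IsHybridEdge N e ⇔ IsHybridEdge rerooted e
  directed-sameHybrid {e} d = mk⇔
    (λ h → refl , subst (2 ≤_) (sym indeg≡) (proj₂ (Equivalence.to (sameHybrid e) h)))
    (λ (_ , h) → Equivalence.from (sameHybrid e) (directedH e , subst (2 ≤_) indeg≡ h))
    where
    head-outside : ¬ InRootComponent N (end₂ G₀ e)
    head-outside c-root = InRootComponent-noDirectedInEdge (proj₂ sdagN) c-root e d
      (sym (proj₂ (directedN⇒sameEnds compatible d)))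
    indeg≡ : indeg rerooted (end₂ rerooted e) ≡ indeg G₀ (end₂ G₀ e)
    indeg≡ = trans (cong (indeg rerooted) (directed-unreversed d))
      (indeg-cong rerooted G₀ (InEdge-outsideRootComponents head-outside))

  undirected-sameHybrid : ∀ {e} → directed N e ≡ false → IsHybridEdge N e ⇔ IsHybridEdge rerooted e
  undirected-sameHybrid u = mk⇔
    (λ (d , _) → contradiction d (not-¬ u))
    (λ (_ , h) → let f , f' , f≢f' , f→ , f'→ = R.hybrid⇒InEdges h in
       contradiction (trans (rerooted-undirected-InEdge-unique u f→)
                            (sym (rerooted-undirected-InEdge-unique u f'→))) f≢f')

  rerooted-sameHybrid : SameHybridEdges N rerooted
  rerooted-sameHybrid e with directed N e ≟ᵇ true
  ... | yes d  = directed-sameHybrid d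
  ... | no  ¬d = undirected-sameHybrid (¬-not ¬d)

  fixed⇒root : ∀ {w} → newRoot w ≡ w → IsRoot rerooted w
  fixed⇒root {w} fixed = R.noInEdge⇒root noInEdge
    where
    noInEdge : ∀ f → ¬ R.InEdge f w
    noInEdge f (_ , f→w) with rerooted-ends f
    ... | inj₂ (¬rev , _ , f₂) = ¬rev
      (InRootComponent⇒undirected f→ (subst (InRootComponent N) fixed (newRoot-InRootComponent w)) ,
       subst OnNewRootPath (sym f→) (0 , fixed))
      where f→ = trans (sym f₂) f→w
    ... | inj₁ ((u , b-onPath) , _ , f₂) =
      ¬Ancestor-parent (head-nonroot f) (subst (Ancestor _) newRoot≡parent b-onPath)
      where
      parent≡w : parent (end₂ G₀ f) ≡ w
      parent≡w = trans (undirected⇒parent u) (trans (sym f₂) f→w)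
      newRoot≡parent : newRoot (end₂ G₀ f) ≡ parent (end₂ G₀ f)
      newRoot≡parent =
        trans (sym (newRoot-parent _)) (trans (cong newRoot parent≡w) (trans fixed (sym parent≡w)))

  root⇒OnNewRootPath : ∀ {w} → IsRoot rerooted w → OnNewRootPath w
  root⇒OnNewRootPath {w} w-root with root? w
  ... | yes w-root₀ = n , trans (rootOf-newRoot w) (parent^-root n w-root₀)
  ... | no ¬w-root₀ with ¬root⇒InEdge ¬w-root₀
  ...   | g , _ , g→w with rerooted-ends g
  ...     | inj₁ (rev , _) = subst OnNewRootPath g→w (proj₂ rev)
  ...     | inj₂ (_ , _ , g₂) = contradiction (refl , trans g₂ g→w) (R.root⇒¬InEdge w-root)

  noRoot-aboveNewRootPath : ∀ {w c} → IsRoot rerooted w → parent c ≡ w → ¬ IsRoot G₀ c →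
    ¬ OnNewRootPath c
  noRoot-aboveNewRootPath w-root c↑≡w ¬c-root c-onPath with parent-InEdge ¬c-root
  ... | h , h→c , h₁ with rerooted-ends h
  ...   | inj₁ (_ , _ , h₂) = R.root⇒¬InEdge w-root (refl , trans h₂ (trans h₁ c↑≡w))
  ...   | inj₂ (¬rev , _)   = ¬rev
    (InRootComponent⇒undirected h→c (OnNewRootPath⇒InRootComponent c-onPath) ,
     subst OnNewRootPath (sym h→c) c-onPath)

  root⇒fixed : ∀ {w} → IsRoot rerooted w → newRoot w ≡ w
  root⇒fixed {w} w-root with newRoot w ≟ w
  ... | yes fixed = fixed
  ... | no  moved with Ancestor-last (root⇒OnNewRootPath w-root) moved
  ...   | c , c↑≡w , c≢w , c≤ =
    contradiction (Ancestor-newRoot⇒OnNewRootPath c≤) (noRoot-aboveNewRootPath w-root c↑≡w ¬c-root)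
    where
    ¬c-root : ¬ IsRoot G₀ c
    ¬c-root c-root = c≢w (trans (sym (parent-root c-root)) c↑≡w)

  image⇔fixed : ∀ w → InImage N ρ w ⇔ newRoot w ≡ w
  image⇔fixed w = mk⇔
    (λ { (v , v-root , refl) →
           proj₂ rootChoice (rootOf (ρ v)) v (rootOf-InRootComponent _) v-root (rootOf-ρ∼ v v-root) })
    (λ fixed → rootOf w , rootOf-InRootComponent w , fixed)
    where
    rootOf-ρ∼ : ∀ v → InRootComponent N v → rootOf (ρ v) ∼⟨ N ⟩ v
    rootOf-ρ∼ v v-root =
      let p = rootOf-SDPath (ρ v) ◅◅ proj₂ (proj₁ rootChoice v v-root) in v-root _ p , p

  rerooted-roots : RootsAreImage N rerooted ρ
  rerooted-roots w = mk⇔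
    (Equivalence.from (image⇔fixed w) ∘ root⇒fixed)
    (fixed⇒root ∘ Equivalence.to (image⇔fixed w))

  rerooted-compatible : Compatible N rerooted
  rerooted-compatible e with rerooted-ends e
  ... | inj₁ ((u , _) , e₁ , e₂) =
    subst₂ (λ a b → SameEnds a b _ _) (sym e₁) (sym e₂) (SameEnds-swap (proj₁ (compatible e))) ,
    λ d → contradiction d (not-¬ u)
  ... | inj₂ (_ , e₁ , e₂) =
    subst₂ (λ a b → SameEnds a b _ _) (sym e₁) (sym e₂) (proj₁ (compatible e)) ,
    λ d → let e₁' , e₂' = directedN⇒sameEnds compatible d in refl , trans e₁ e₁' , trans e₂ e₂'

  rerooted-noLoop : ∀ e → end₁ rerooted e ≢ end₂ rerooted e
  rerooted-noLoop e loop with rerooted-ends e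
  ... | inj₁ (_ , e₁ , e₂) = noLoopH e (sym (trans (sym e₁) (trans loop e₂)))
  ... | inj₂ (_ , e₁ , e₂) = noLoopH e (trans (sym e₁) (trans loop e₂))

  rerooted-isSDAG : IsSDAG rerooted
  rerooted-isSDAG =
    (rerooted-noLoop , λ { _ _ () _ _ }) , proj₂ sdagN ∘ SDCycle-compatible rerooted-compatible

  rerooted-isRootedPartner : IsRootedPartner N rerooted
  rerooted-isRootedPartner =
    (rerooted-isSDAG , λ _ → refl) , rerooted-isSDAG , sdagN , rerooted-compatible , rerooted-sameHybrid

proposition7 : ∀ (n m : ℕ) (N : SDGraph n m) → IsNetwork N →
    ((ρ : Fin n → Fin n) → IsRootChoice N ρ →
      Σ (SDGraph n m) λ G → (IsRootedPartner N G × RootsAreImage N G ρ) ×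
        (∀ (G' : SDGraph n m) → IsRootedPartner N G' → RootsAreImage N G' ρ → SameGraph G' G))
    ×
    ((G : SDGraph n m) → IsRootedPartner N G →
      Σ (Fin n → Fin n) λ ρ → (IsRootChoice N ρ × RootsAreImage N G ρ) ×
        (∀ (ρ' : Fin n → Fin n) → IsRootChoice N ρ' → RootsAreImage N G ρ' → SameRootChoice N ρ' ρ))
proposition7 n m N (_ , G₀ , partner₀) =
  (λ ρ rootChoice → let open Reroot partner₀ rootChoice in
    rerooted , (rerooted-isRootedPartner , rerooted-roots) ,
    λ G' partner' roots' → rootedPartner-determinedByRoots rerooted-isRootedPartner partner'
      λ w → Equivalence.from (roots' w) ∘ Equivalence.to (rerooted-roots w)) ,
  (λ G partner → let open RootedPartner N G partner in
    rootOf , (rootOf-isRootChoice , rootOf-roots) ,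
    λ ρ' rootChoice' roots' → rootChoice-unique rootChoice' rootOf-isRootChoice
      λ w → Equivalence.to (rootOf-roots w) ∘ Equivalence.from (roots' w))
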